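{- Every descendant chain $U$ satisfies $\mathbf{s}_i\times\mathbf{s}_j>0$ for all $1\le i<j\le 4$, where $\mathbf{s}_1,\dots,\mathbf{s}_8$ are its neighbourhood vectors.
   Context: Words are over $\{\mathsf{R},\mathsf{L},\mathsf{U},\mathsf{D}\}$ with reversal $\mathsf{R}\leftrightarrow\mathsf{L}$, $\mathsf{U}\leftrightarrow\mathsf{D}$, and $(w_1\cdots w_k)^{ -1}=w_k^{ -1}\cdots w_1^{ -1}$. Chains $U_1:\cdots:U_8$ have indices modulo $8$. Lifts, for $V=\varphi(U)$: - $f_i$, for $i=1,\dots,4$: $V_j=U_j$ for $j\not\equiv i\pmod 4$, and $V_j=(U_{j+3}U_{j+4}U_{j+5})^{ -1}$ for $j\equiv i\pmod 4$. - $g^\star_{\mathrm{odd}}$: $V_i=(U_{i-2}\cdots U_{i+2})^{ -1}$ for odd $i$, and $V_i=U_{i+3}U_{i+4}U_{i+5}$ for even $i$. - $g^\star_{\mathrm{even}}$: "odd" and "even" swapped. A descendant chain is obtained from the Greek cross $\mathsf{R}:\mathsf{U}\mathsf{R}:\mathsf{U}:\mathsf{L}\mathsf{U}:\mathsf{L}:\mathsf{D}\mathsf{L}:\mathsf{D}:\mathsf{R}\mathsf{D}$ by a finite sequence of these maps. The span of a word is $(\#\mathsf{R}-\#\mathsf{L},\ \#\mathsf{U}-\#\mathsf{D})$. The neighbourhood vector $\mathbf{s}_i$ is the span of $U_iU_{i+1}$. For vectors, $(x_1,y_1)\times(x_2,y_2)=x_1y_2-y_1x_2$. -}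

module Defs where

open import Data.Nat using (ℕ; suc; _+_; _%_)
open import Data.Nat.Properties using ()
open import Data.Integer using (ℤ; +_; _-_; _*_)
open import Data.Fin using (Fin; toℕ; fromℕ<)
open import Data.Nat.DivMod using (m%n<n)
open import Data.List using (List; []; _∷_; _++_; reverse; map)
open import Data.Bool using (Bool; true; false; if_then_else_)
open import Data.Nat using (_≡ᵇ_)
open import Data.Product using (_×_; _,_)

data Letter : Set where
  R L U D : Letter

Word : Set
Word = List Letter

inv : Letter → Letter
inv R = L
inv L = R
inv U = D
inv D = U

_⁻¹ : Word → Word
w ⁻¹ = reverse (map inv w)

-- A chain U₁:⋯:U₈; index j (mod 8) is stored at Fin (j mod 8), so U₈ is at 0.
Chain : Set
Chain = Fin 8 → Word

at : Chain → ℕ → Word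
at c j = c (fromℕ< (m%n<n j 8))

-- Negative offsets are represented by adding multiples of 8 (indices mod 8).
-- Lift f_i (i = 1..4): V_j = U_j if j ≢ i (mod 4), else (U_{j+3}U_{j+4}U_{j+5})⁻¹
f : ℕ → Chain → Chain
f i c k = let j = toℕ k in
  if (j % 4) ≡ᵇ (i % 4)
  then (at c (j + 3) ++ at c (j + 4) ++ at c (j + 5)) ⁻¹
  else c k

-- g*_odd: V_i = (U_{i-2}⋯U_{i+2})⁻¹ for odd i; V_i = U_{i+3}U_{i+4}U_{i+5} for even i.
-- g*_even: same with odd and even swapped.
gstar : ℕ → Chain → Chain
gstar p c k = let i = toℕ k in
  if (i % 2) ≡ᵇ p
  then (at c (i + 6) ++ at c (i + 7) ++ at c i ++ at c (i + 1) ++ at c (i + 2)) ⁻¹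
  else at c (i + 3) ++ at c (i + 4) ++ at c (i + 5)

g-odd : Chain → Chain
g-odd = gstar 1

g-even : Chain → Chain
g-even = gstar 0

greekCross : Chain
greekCross k = at' (toℕ k)
  where
  at' : ℕ → Word
  at' 1 = R ∷ []
  at' 2 = U ∷ R ∷ []
  at' 3 = U ∷ []
  at' 4 = L ∷ U ∷ []
  at' 5 = L ∷ []
  at' 6 = D ∷ L ∷ []
  at' 7 = D ∷ []
  at' _ = R ∷ D ∷ []   -- index 0 ≡ 8

data Descendant : Chain → Set where
  base  : Descendant greekCross
  stepf : ∀ {c} (i : ℕ) → 1 Data.Nat.≤ i → i Data.Nat.≤ 4 → Descendant c → Descendant (f i c)
  stepgo : ∀ {c} → Descendant c → Descendant (g-odd c)
  stepge : ∀ {c} → Descendant c → Descendant (g-even c)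

Vec2 : Set
Vec2 = ℤ × ℤ

letterSpan : Letter → Vec2
letterSpan R = (+ 1 , + 0)
letterSpan L = (Data.Integer.- (+ 1) , + 0)
letterSpan U = (+ 0 , + 1)
letterSpan D = (+ 0 , Data.Integer.- (+ 1))

addV : Vec2 → Vec2 → Vec2
addV (a , b) (c , d) = (a Data.Integer.+ c , b Data.Integer.+ d)

span : Word → Vec2
span [] = (+ 0 , + 0)
span (x ∷ w) = addV (letterSpan x) (span w)

nbhd : Chain → ℕ → Vec2
nbhd c i = span (at c i ++ at c (suc i))

cross : Vec2 → Vec2 → ℤ
cross (x₁ , y₁) (x₂ , y₂) = x₁ * y₂ - y₁ * x₂

-- The spans of a descendant chain always have the form a₁, a₂, a₃, a₄, −a₁, −a₂, −a₃, −a₄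
-- with aᵢ × aⱼ > 0 for i < j. Span turns concatenation into addition and inversion into
-- negation, so a lift replaces each aₖ by an integer combination of the old frame, and each
-- neighbourhood vector is such a combination too. By the Cauchy–Binet formula
--   (Σ lₖ aₖ) × (Σ mₖ aₖ) = Σ_{i<j} (lᵢ mⱼ − mᵢ lⱼ) (aᵢ × aⱼ),
-- such a cross product is positive as soon as all minors lᵢ mⱼ − mᵢ lⱼ are non-negative and
-- one of them is positive. For the finitely many coefficient vectors produced by the six
-- lifts and by s₁, …, s₄ this is a sign check on explicit integers, decided by evaluation.

{-# OPTIONS --safe #-}
module Submission where

open import Defs
open import Data.Nat using (ℕ; _≤_; _<_)
open import Data.Integer using (+_) renaming (_<_ to _<ℤ_)

open import Data.Nat as ℕ using (zero; suc; s≤s; z≤n; _%_; _≡ᵇ_)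
open import Data.Nat.DivMod using (m%n<n)
open import Data.Nat.Properties using (allUpTo?)
open import Data.Integer as ℤ using (ℤ; 0ℤ; -_; _+_; _*_; +≤+; +<+) renaming (_≤_ to _≤ℤ_)
import Data.Integer.Properties as ℤ
open import Algebra.Properties.CommutativeSemigroup ℤ.+-commutativeSemigroup using (interchange)
open import Data.Integer.Tactic.RingSolver using (solve-∀)
open import Data.Fin using (Fin; zero; suc; toℕ; fromℕ<)
import Data.Fin.Properties as Fin
open import Data.List using (List; []; _∷_; _++_; reverse; map)
open import Data.List.Properties using (unfold-reverse)
open import Data.Vec as Vec using (Vec; []; _∷_; lookup; replicate; zip)
open import Data.Vec.Properties using (map-∘; map-cong; ≡-dec)
open import Data.Vec.Relation.Unary.All as All using (All; []; _∷_)
open import Data.Vec.Relation.Unary.Any as Any using (Any; here; there)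
open import Data.Vec.Relation.Unary.AllPairs as AllPairs using (AllPairs; []; _∷_)
import Data.Vec.Relation.Unary.AllPairs.Properties as AllPairs
open import Data.Product using (_×_; _,_)
import Data.Product.Properties as Product
open import Data.Bool using (true; false; if_then_else_)
open import Data.Unit using (tt)
open import Function using (_∘_)
open import Relation.Binary.PropositionalEquality
open import Relation.Nullary.Decidable using (Dec; True; toWitness; _×-dec_; _→-dec_)

private
  variable
    n : ℕ
    X : Set

0V : Vec2
0V = + 0 , + 0

negV : Vec2 → Vec2
negV (x , y) = - x , - y

addV-identityˡ : ∀ p → addV 0V p ≡ p
addV-identityˡ (x , y) = cong₂ _,_ (ℤ.+-identityˡ x) (ℤ.+-identityˡ y)

addV-identityʳ : ∀ p → addV p 0V ≡ p
addV-identityʳ (x , y) = cong₂ _,_ (ℤ.+-identityʳ x) (ℤ.+-identityʳ y)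

addV-comm : ∀ p q → addV p q ≡ addV q p
addV-comm (x , y) (x′ , y′) = cong₂ _,_ (ℤ.+-comm x x′) (ℤ.+-comm y y′)

addV-assoc : ∀ p q r → addV (addV p q) r ≡ addV p (addV q r)
addV-assoc (x , y) (x′ , y′) (x″ , y″) = cong₂ _,_ (ℤ.+-assoc x x′ x″) (ℤ.+-assoc y y′ y″)

addV-interchange : ∀ p q r s → addV (addV p q) (addV r s) ≡ addV (addV p r) (addV q s)
addV-interchange (a , a′) (b , b′) (c , c′) (d , d′) =
  cong₂ _,_ (interchange a b c d) (interchange a′ b′ c′ d′)

negV-addV : ∀ p q → negV (addV p q) ≡ addV (negV p) (negV q)
negV-addV (x , y) (x′ , y′) = cong₂ _,_ (ℤ.neg-distrib-+ x x′) (ℤ.neg-distrib-+ y y′)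

span-++ : ∀ u w → span (u ++ w) ≡ addV (span u) (span w)
span-++ []      w = sym (addV-identityˡ (span w))
span-++ (x ∷ u) w = begin
  addV (letterSpan x) (span (u ++ w))            ≡⟨ cong (addV (letterSpan x)) (span-++ u w) ⟩
  addV (letterSpan x) (addV (span u) (span w))   ≡⟨ addV-assoc (letterSpan x) (span u) (span w) ⟨
  addV (addV (letterSpan x) (span u)) (span w)   ∎
  where open ≡-Reasoning

span-reverse : ∀ w → span (reverse w) ≡ span w
span-reverse []      = refl
span-reverse (x ∷ w) = begin
  span (reverse (x ∷ w))                           ≡⟨ cong span (unfold-reverse x w) ⟩
  span (reverse w ++ x ∷ [])                       ≡⟨ span-++ (reverse w) (x ∷ []) ⟩
  addV (span (reverse w)) (addV (letterSpan x) 0V) ≡⟨ cong₂ addV (span-reverse w) (addV-identityʳ (letterSpan x)) ⟩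
  addV (span w) (letterSpan x)                     ≡⟨ addV-comm (span w) (letterSpan x) ⟩
  span (x ∷ w)                                     ∎
  where open ≡-Reasoning

letterSpan-inv : ∀ x → letterSpan (inv x) ≡ negV (letterSpan x)
letterSpan-inv R = refl
letterSpan-inv L = refl
letterSpan-inv U = refl
letterSpan-inv D = refl

span-map-inv : ∀ w → span (map inv w) ≡ negV (span w)
span-map-inv []      = refl
span-map-inv (x ∷ w) = begin
  addV (letterSpan (inv x)) (span (map inv w))   ≡⟨ cong₂ addV (letterSpan-inv x) (span-map-inv w) ⟩
  addV (negV (letterSpan x)) (negV (span w))     ≡⟨ negV-addV (letterSpan x) (span w) ⟨
  negV (span (x ∷ w))                            ∎
  where open ≡-Reasoning

span-⁻¹ : ∀ w → span (w ⁻¹) ≡ negV (span w)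
span-⁻¹ w = trans (span-reverse (map inv w)) (span-map-inv w)

index : (Fin 8 → X) → ℕ → X
index c j = c (fromℕ< (m%n<n j 8))

-- Instantiated at _⁻¹ and _++_ these are f and gstar on the nose; instantiated
-- at negV and addV they act on spans, and at coefficient vectors they compute
-- the spans of a lifted chain symbolically.
module Lifts (neg : X → X) (add : X → X → X) where

  joinAt : (Fin 8 → X) → ℕ → List ℕ → X
  joinAt c j []        = index c j
  joinAt c j (j′ ∷ js) = add (index c j) (joinAt c j′ js)

  opposite : (Fin 8 → X) → Fin 8 → X
  opposite c k = joinAt c (toℕ k ℕ.+ 3) (toℕ k ℕ.+ 4 ∷ toℕ k ℕ.+ 5 ∷ [])

  around : (Fin 8 → X) → Fin 8 → X
  around c k = joinAt c (toℕ k ℕ.+ 6) (toℕ k ℕ.+ 7 ∷ toℕ k ∷ toℕ k ℕ.+ 1 ∷ toℕ k ℕ.+ 2 ∷ [])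

  liftF : ℕ → (Fin 8 → X) → Fin 8 → X
  liftF i c k = if toℕ k % 4 ≡ᵇ i % 4 then neg (opposite c k) else c k

  liftG : ℕ → (Fin 8 → X) → Fin 8 → X
  liftG p c k = if toℕ k % 2 ≡ᵇ p then neg (around c k) else opposite c k

module LiftsNatural {X Y : Set} {negX : X → X} {addX : X → X → X} {negY : Y → Y} {addY : Y → Y → Y}
  (h : X → Y) (h-neg : ∀ x → h (negX x) ≡ negY (h x)) (h-add : ∀ x y → h (addX x y) ≡ addY (h x) (h y))
  where

  private
    module LX = Lifts negX addX
    module LY = Lifts negY addY

  joinAt-natural : ∀ {c c′} → h ∘ c ≗ c′ → ∀ j js → h (LX.joinAt c j js) ≡ LY.joinAt c′ j js
  joinAt-natural h∘c≗c′ j []        = h∘c≗c′ _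
  joinAt-natural h∘c≗c′ j (j′ ∷ js) =
    trans (h-add _ _) (cong₂ addY (h∘c≗c′ _) (joinAt-natural h∘c≗c′ j′ js))

  opposite-natural : ∀ {c c′} → h ∘ c ≗ c′ → h ∘ LX.opposite c ≗ LY.opposite c′
  opposite-natural h∘c≗c′ k = joinAt-natural h∘c≗c′ (toℕ k ℕ.+ 3) (toℕ k ℕ.+ 4 ∷ toℕ k ℕ.+ 5 ∷ [])

  around-natural : ∀ {c c′} → h ∘ c ≗ c′ → h ∘ LX.around c ≗ LY.around c′
  around-natural h∘c≗c′ k =
    joinAt-natural h∘c≗c′ (toℕ k ℕ.+ 6) (toℕ k ℕ.+ 7 ∷ toℕ k ∷ toℕ k ℕ.+ 1 ∷ toℕ k ℕ.+ 2 ∷ [])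

  liftF-natural : ∀ i {c c′} → h ∘ c ≗ c′ → h ∘ LX.liftF i c ≗ LY.liftF i c′
  liftF-natural i h∘c≗c′ k with toℕ k % 4 ≡ᵇ i % 4
  ... | true  = trans (h-neg _) (cong negY (opposite-natural h∘c≗c′ k))
  ... | false = h∘c≗c′ k

  liftG-natural : ∀ p {c c′} → h ∘ c ≗ c′ → h ∘ LX.liftG p c ≗ LY.liftG p c′
  liftG-natural p h∘c≗c′ k with toℕ k % 2 ≡ᵇ p
  ... | true  = trans (h-neg _) (cong negY (around-natural h∘c≗c′ k))
  ... | false = opposite-natural h∘c≗c′ k

scale : ℤ → Vec2 → Vec2
scale l (x , y) = l * x , l * y

scale-identity : ∀ p → scale (+ 1) p ≡ p
scale-identity (x , y) = cong₂ _,_ (ℤ.*-identityˡ x) (ℤ.*-identityˡ y)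

scale-neg : ∀ l p → scale (- l) p ≡ negV (scale l p)
scale-neg l (x , y) = cong₂ _,_ (sym (ℤ.neg-distribˡ-* l x)) (sym (ℤ.neg-distribˡ-* l y))

scale-distrib : ∀ l m p → scale (l + m) p ≡ addV (scale l p) (scale m p)
scale-distrib l m (x , y) = cong₂ _,_ (ℤ.*-distribʳ-+ x l m) (ℤ.*-distribʳ-+ y l m)

negC : Vec ℤ n → Vec ℤ n
negC = Vec.map -_

addC : Vec ℤ n → Vec ℤ n → Vec ℤ n
addC = Vec.zipWith _+_

combine : Vec Vec2 n → Vec ℤ n → Vec2
combine []      []       = 0V
combine (a ∷ A) (l ∷ ls) = addV (scale l a) (combine A ls)

combine-negC : (A : Vec Vec2 n) → ∀ ls → combine A (negC ls) ≡ negV (combine A ls)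
combine-negC []      []       = refl
combine-negC (a ∷ A) (l ∷ ls) = begin
  addV (scale (- l) a) (combine A (negC ls))    ≡⟨ cong₂ addV (scale-neg l a) (combine-negC A ls) ⟩
  addV (negV (scale l a)) (negV (combine A ls)) ≡⟨ negV-addV (scale l a) (combine A ls) ⟨
  negV (combine (a ∷ A) (l ∷ ls))               ∎
  where open ≡-Reasoning

combine-addC : (A : Vec Vec2 n) → ∀ ls ms → combine A (addC ls ms) ≡ addV (combine A ls) (combine A ms)
combine-addC []      []       []       = refl
combine-addC (a ∷ A) (l ∷ ls) (m ∷ ms) = begin
  addV (scale (l + m) a) (combine A (addC ls ms))
    ≡⟨ cong₂ addV (scale-distrib l m a) (combine-addC A ls ms) ⟩
  addV (addV (scale l a) (scale m a)) (addV (combine A ls) (combine A ms))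
    ≡⟨ addV-interchange (scale l a) (scale m a) (combine A ls) (combine A ms) ⟩
  addV (combine (a ∷ A) (l ∷ ls)) (combine (a ∷ A) (m ∷ ms))
    ∎
  where open ≡-Reasoning

basis : Vec (Vec ℤ n) n
basis {zero}  = []
basis {suc n} = (+ 1 ∷ replicate n 0ℤ) ∷ Vec.map (0ℤ ∷_) basis

combine-zeros : (A : Vec Vec2 n) → combine A (replicate n 0ℤ) ≡ 0V
combine-zeros []      = refl
combine-zeros (a ∷ A) = cong (addV 0V) (combine-zeros A)

combine-basis : (A : Vec Vec2 n) → Vec.map (combine A) basis ≡ A
combine-basis []      = refl
combine-basis (a ∷ A) = cong₂ _∷_ head tail
  where
  open ≡-Reasoning
  head : combine (a ∷ A) (+ 1 ∷ replicate _ 0ℤ) ≡ a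
  head = begin
    addV (scale (+ 1) a) (combine A (replicate _ 0ℤ)) ≡⟨ cong₂ addV (scale-identity a) (combine-zeros A) ⟩
    addV a 0V                                         ≡⟨ addV-identityʳ a ⟩
    a                                                 ∎
  tail : Vec.map (combine (a ∷ A)) (Vec.map (0ℤ ∷_) basis) ≡ A
  tail = begin
    Vec.map (combine (a ∷ A)) (Vec.map (0ℤ ∷_) basis) ≡⟨ map-∘ (combine (a ∷ A)) (0ℤ ∷_) basis ⟨
    Vec.map (combine (a ∷ A) ∘ (0ℤ ∷_)) basis         ≡⟨ map-cong (addV-identityˡ ∘ combine A) basis ⟩
    Vec.map (combine A) basis                         ≡⟨ combine-basis A ⟩
    A                                                 ∎

dot : Vec ℤ n → Vec ℤ n → ℤ
dot []       []       = 0ℤ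
dot (u ∷ us) (v ∷ vs) = u * v + dot us vs

crosses : Vec Vec2 4 → Vec ℤ 6
crosses (a₁ ∷ a₂ ∷ a₃ ∷ a₄ ∷ []) =
  cross a₁ a₂ ∷ cross a₁ a₃ ∷ cross a₁ a₄ ∷ cross a₂ a₃ ∷ cross a₂ a₄ ∷ cross a₃ a₄ ∷ []

-- crosses (zip l m) lists the 2×2 minors lᵢ mⱼ − mᵢ lⱼ of the coefficient matrix (l ; m).
cauchy-binet : ∀ A l m → cross (combine A l) (combine A m) ≡ dot (crosses (zip l m)) (crosses A)
cauchy-binet ((x₁ , y₁) ∷ (x₂ , y₂) ∷ (x₃ , y₃) ∷ (x₄ , y₄) ∷ [])
             (l₁ ∷ l₂ ∷ l₃ ∷ l₄ ∷ []) (m₁ ∷ m₂ ∷ m₃ ∷ m₄ ∷ []) =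
  identity l₁ l₂ l₃ l₄ m₁ m₂ m₃ m₄ x₁ x₂ x₃ x₄ y₁ y₂ y₃ y₄
  where
  identity : ∀ l₁ l₂ l₃ l₄ m₁ m₂ m₃ m₄ x₁ x₂ x₃ x₄ y₁ y₂ y₃ y₄ →
    (l₁ * x₁ + (l₂ * x₂ + (l₃ * x₃ + (l₄ * x₄ + 0ℤ)))) * (m₁ * y₁ + (m₂ * y₂ + (m₃ * y₃ + (m₄ * y₄ + 0ℤ))))
      ℤ.- (l₁ * y₁ + (l₂ * y₂ + (l₃ * y₃ + (l₄ * y₄ + 0ℤ)))) * (m₁ * x₁ + (m₂ * x₂ + (m₃ * x₃ + (m₄ * x₄ + 0ℤ))))
    ≡ (l₁ * m₂ ℤ.- m₁ * l₂) * (x₁ * y₂ ℤ.- y₁ * x₂) + ((l₁ * m₃ ℤ.- m₁ * l₃) * (x₁ * y₃ ℤ.- y₁ * x₃)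
      + ((l₁ * m₄ ℤ.- m₁ * l₄) * (x₁ * y₄ ℤ.- y₁ * x₄) + ((l₂ * m₃ ℤ.- m₂ * l₃) * (x₂ * y₃ ℤ.- y₂ * x₃)
      + ((l₂ * m₄ ℤ.- m₂ * l₄) * (x₂ * y₄ ℤ.- y₂ * x₄) + ((l₃ * m₄ ℤ.- m₃ * l₄) * (x₃ * y₄ ℤ.- y₃ * x₄) + 0ℤ)))))
  identity = solve-∀

*-nonNegative : ∀ {i j} → 0ℤ ≤ℤ i → 0ℤ ≤ℤ j → 0ℤ ≤ℤ i * j
*-nonNegative {+ m} {+ n} _ _ = subst (0ℤ ≤ℤ_) (ℤ.pos-* m n) (+≤+ z≤n)

*-positive : ∀ {i j} → 0ℤ <ℤ i → 0ℤ <ℤ j → 0ℤ <ℤ i * j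
*-positive {+ suc m} {+ suc n} _        _        = +<+ (s≤s z≤n)
*-positive {+ zero}            (+<+ ()) _
*-positive {_}       {+ zero}  _        (+<+ ())

dot-nonNegative : {us vs : Vec ℤ n} → All (0ℤ ≤ℤ_) us → All (0ℤ ≤ℤ_) vs → 0ℤ ≤ℤ dot us vs
dot-nonNegative []         []         = +≤+ z≤n
dot-nonNegative (u≥0 ∷ us) (v≥0 ∷ vs) = ℤ.+-mono-≤ (*-nonNegative u≥0 v≥0) (dot-nonNegative us vs)

dot-positive : {us vs : Vec ℤ n} → All (0ℤ ≤ℤ_) us → Any (0ℤ <ℤ_) us → All (0ℤ <ℤ_) vs → 0ℤ <ℤ dot us vs
dot-positive (_ ∷ us) (here u>0) (v>0 ∷ vs) =
  ℤ.+-mono-<-≤ (*-positive u>0 v>0) (dot-nonNegative us (All.map ℤ.<⇒≤ vs))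
dot-positive (u≥0 ∷ us) (there any) (v>0 ∷ vs) =
  ℤ.+-mono-≤-< (*-nonNegative u≥0 (ℤ.<⇒≤ v>0)) (dot-positive us any vs)

PositiveFrame : Vec Vec2 n → Set
PositiveFrame = AllPairs (λ a b → 0ℤ <ℤ cross a b)

positiveFrame⇒crosses-positive : ∀ {A} → PositiveFrame A → All (0ℤ <ℤ_) (crosses A)
positiveFrame⇒crosses-positive ((p₁₂ ∷ p₁₃ ∷ p₁₄ ∷ []) ∷ (p₂₃ ∷ p₂₄ ∷ []) ∷ (p₃₄ ∷ []) ∷ [] ∷ []) =
  p₁₂ ∷ p₁₃ ∷ p₁₄ ∷ p₂₃ ∷ p₂₄ ∷ p₃₄ ∷ []

_≺_ : Vec ℤ 4 → Vec ℤ 4 → Set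
l ≺ m = All (0ℤ ≤ℤ_) (crosses (zip l m)) × Any (0ℤ <ℤ_) (crosses (zip l m))

_≺?_ : ∀ l m → Dec (l ≺ m)
l ≺? m = All.all? (0ℤ ℤ.≤?_) (crosses (zip l m)) ×-dec Any.any? (0ℤ ℤ.<?_) (crosses (zip l m))

≺⇒cross-positive : ∀ {A l m} → PositiveFrame A → l ≺ m → 0ℤ <ℤ cross (combine A l) (combine A m)
≺⇒cross-positive {A} {l} {m} A-pos (minors≥0 , minor>0) =
  subst (0ℤ <ℤ_) (sym (cauchy-binet A l m)) (dot-positive minors≥0 minor>0 (positiveFrame⇒crosses-positive A-pos))

positiveFrame-combine : ∀ {A} {Q : Vec (Vec ℤ 4) n} → PositiveFrame A → AllPairs _≺_ Q → PositiveFrame (Vec.map (combine A) Q)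
positiveFrame-combine A-pos Q≺ = AllPairs.map⁺ (AllPairs.map (≺⇒cross-positive A-pos) Q≺)

-- Index 0 holds U₈, hence the leading −a₄.
antipodal : (X → X) → Vec X 4 → Fin 8 → X
antipodal neg (a₁ ∷ a₂ ∷ a₃ ∷ a₄ ∷ []) =
  lookup (neg a₄ ∷ a₁ ∷ a₂ ∷ a₃ ∷ a₄ ∷ neg a₁ ∷ neg a₂ ∷ neg a₃ ∷ [])

corners : (Fin 8 → X) → Vec X 4
corners c = c (suc zero) ∷ c (suc (suc zero)) ∷ c (suc (suc (suc zero))) ∷ c (suc (suc (suc (suc zero)))) ∷ []

antipodal-natural : ∀ {X Y : Set} {negX : X → X} {negY : Y → Y} (h : X → Y) →
  (∀ x → h (negX x) ≡ negY (h x)) → ∀ A → h ∘ antipodal negX A ≗ antipodal negY (Vec.map h A)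
antipodal-natural h h-neg (_ ∷ _ ∷ _ ∷ _ ∷ []) zero                                          = h-neg _
antipodal-natural h h-neg (_ ∷ _ ∷ _ ∷ _ ∷ []) (suc zero)                                    = refl
antipodal-natural h h-neg (_ ∷ _ ∷ _ ∷ _ ∷ []) (suc (suc zero))                              = refl
antipodal-natural h h-neg (_ ∷ _ ∷ _ ∷ _ ∷ []) (suc (suc (suc zero)))                        = refl
antipodal-natural h h-neg (_ ∷ _ ∷ _ ∷ _ ∷ []) (suc (suc (suc (suc zero))))                  = refl
antipodal-natural h h-neg (_ ∷ _ ∷ _ ∷ _ ∷ []) (suc (suc (suc (suc (suc zero)))))            = h-neg _
antipodal-natural h h-neg (_ ∷ _ ∷ _ ∷ _ ∷ []) (suc (suc (suc (suc (suc (suc zero))))))      = h-neg _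
antipodal-natural h h-neg (_ ∷ _ ∷ _ ∷ _ ∷ []) (suc (suc (suc (suc (suc (suc (suc zero))))))) = h-neg _

IsAntipodal : (Fin 8 → Vec ℤ 4) → Set
IsAntipodal T = T ≗ antipodal negC (corners T)

isAntipodal? : ∀ T → Dec (IsAntipodal T)
isAntipodal? T = Fin.all? λ k → ≡-dec ℤ._≟_ (T k) (antipodal negC (corners T) k)

generic : Fin 8 → Vec ℤ 4
generic = antipodal negC basis

combine-generic : ∀ A → combine A ∘ generic ≗ antipodal negV A
combine-generic A k =
  trans (antipodal-natural {negY = negV} (combine A) (combine-negC A) basis k) (cong (λ B → antipodal negV B k) (combine-basis A))

record Framed (c : Chain) : Set where
  constructor framed
  field
    frame    : Vec Vec2 4
    positive : PositiveFrame frame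
    spans    : span ∘ c ≗ antipodal negV frame

open Framed

spans-generic : ∀ {c} (F : Framed c) → span ∘ c ≗ combine (frame F) ∘ generic
spans-generic F k = trans (spans F k) (sym (combine-generic (frame F) k))

framed-step : ∀ {c c′ : Chain} {T : Fin 8 → Vec ℤ 4} →
  (∀ A → span ∘ c ≗ combine A ∘ generic → span ∘ c′ ≗ combine A ∘ T) →
  True (isAntipodal? T) → True (AllPairs.allPairs? _≺?_ (corners T)) → Framed c → Framed c′
framed-step {c′ = c′} {T} transport antipodal-T ordered-T F@(framed A A-pos _) =
  framed (Vec.map (combine A) (corners T)) (positiveFrame-combine A-pos (toWitness ordered-T)) c′≗A′
  where
  open ≡-Reasoning
  c′≗A′ : span ∘ c′ ≗ antipodal negV (Vec.map (combine A) (corners T))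
  c′≗A′ k = begin
    span (c′ k)                                ≡⟨ transport A (spans-generic F) k ⟩
    combine A (T k)                            ≡⟨ cong (combine A) (toWitness antipodal-T k) ⟩
    combine A (antipodal negC (corners T) k)   ≡⟨ antipodal-natural {negY = negV} (combine A) (combine-negC A) (corners T) k ⟩
    antipodal negV (Vec.map (combine A) (corners T)) k ∎

module SpanLifts = LiftsNatural {negX = _⁻¹} {addX = _++_} {negY = negV} {addY = addV} span span-⁻¹ span-++

module CombineLifts {n} (A : Vec Vec2 n) =
  LiftsNatural {negX = negC} {addX = addC} {negY = negV} {addY = addV} (combine A) (combine-negC A) (combine-addC A)

f-transport : ∀ i {c} A → span ∘ c ≗ combine A ∘ generic →
  span ∘ f i c ≗ combine A ∘ Lifts.liftF negC addC i generic
f-transport i A c≗A k =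
  trans (SpanLifts.liftF-natural i c≗A k) (sym (CombineLifts.liftF-natural A i {generic} (λ _ → refl) k))

gstar-transport : ∀ p {c} A → span ∘ c ≗ combine A ∘ generic →
  span ∘ gstar p c ≗ combine A ∘ Lifts.liftG negC addC p generic
gstar-transport p A c≗A k =
  trans (SpanLifts.liftG-natural p c≗A k) (sym (CombineLifts.liftG-natural A p {generic} (λ _ → refl) k))

framed-f : ∀ {c} i → 1 ≤ i → i ≤ 4 → Framed c → Framed (f i c)
framed-f 1 _ _ = framed-step (f-transport 1) tt tt
framed-f 2 _ _ = framed-step (f-transport 2) tt tt
framed-f 3 _ _ = framed-step (f-transport 3) tt tt
framed-f 4 _ _ = framed-step (f-transport 4) tt tt
framed-f 0 () _
framed-f (suc (suc (suc (suc (suc _))))) _ (s≤s (s≤s (s≤s (s≤s ()))))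

framed-gstar : ∀ {c} p → p ≤ 1 → Framed c → Framed (gstar p c)
framed-gstar 0 _ = framed-step (gstar-transport 0) tt tt
framed-gstar 1 _ = framed-step (gstar-transport 1) tt tt
framed-gstar (suc (suc _)) (s≤s ())

greekCross-framed : Framed greekCross
greekCross-framed = framed A₀ (toWitness {a? = positive?} tt) (toWitness {a? = spans?} tt)
  where
  A₀ : Vec Vec2 4
  A₀ = (+ 1 , + 0) ∷ (+ 1 , + 1) ∷ (+ 0 , + 1) ∷ (- + 1 , + 1) ∷ []
  positive? : Dec (PositiveFrame A₀)
  positive? = AllPairs.allPairs? (λ a b → 0ℤ ℤ.<? cross a b) A₀
  spans? : Dec (span ∘ greekCross ≗ antipodal negV A₀)
  spans? = Fin.all? λ k → Product.≡-dec ℤ._≟_ ℤ._≟_ (span (greekCross k)) (antipodal negV A₀ k)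

descendant-framed : ∀ {c} → Descendant c → Framed c
descendant-framed base                = greekCross-framed
descendant-framed (stepf i 1≤i i≤4 d) = framed-f i 1≤i i≤4 (descendant-framed d)
descendant-framed (stepgo d)          = framed-gstar 1 (s≤s z≤n) (descendant-framed d)
descendant-framed (stepge d)          = framed-gstar 0 z≤n (descendant-framed d)

neighbourhood : ℕ → Vec ℤ 4
neighbourhood n = addC (index generic n) (index generic (suc n))

nbhd-combine : ∀ {c} (F : Framed c) n → nbhd c n ≡ combine (frame F) (neighbourhood n)
nbhd-combine {c} F n = begin
  span (at c n ++ at c (suc n))                     ≡⟨ span-++ (at c n) (at c (suc n)) ⟩
  addV (span (at c n)) (span (at c (suc n)))        ≡⟨ cong₂ addV (spans-generic F _) (spans-generic F _) ⟩
  addV (combine A (index generic n)) (combine A (index generic (suc n)))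
                                                    ≡⟨ combine-addC A (index generic n) (index generic (suc n)) ⟨
  combine A (neighbourhood n)                       ∎
  where
  open ≡-Reasoning
  A : Vec Vec2 4
  A = frame F

neighbourhoods-ordered : ∀ {i j} → 1 ≤ i → i < j → j ≤ 4 → neighbourhood i ≺ neighbourhood j
neighbourhoods-ordered 1≤i i<j j≤4 = toWitness {a? = all-pairs?} tt (s≤s j≤4) i<j 1≤i
  where
  all-pairs? : Dec (∀ {j} → j < 5 → ∀ {i} → i < j → 1 ≤ i → neighbourhood i ≺ neighbourhood j)
  all-pairs? = allUpTo? (λ j → allUpTo? (λ i → (1 ℕ.≤? i) →-dec (neighbourhood i ≺? neighbourhood j)) j) 5

lemma14 : (c : Chain) → Descendant c →
    (i j : ℕ) → 1 ≤ i → i < j → j ≤ 4 →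
    + 0 <ℤ cross (nbhd c i) (nbhd c j)
lemma14 c d i j 1≤i i<j j≤4 =
  subst₂ (λ s t → 0ℤ <ℤ cross s t) (sym (nbhd-combine F i)) (sym (nbhd-combine F j))
    (≺⇒cross-positive (positive F) (neighbourhoods-ordered 1≤i i<j j≤4))
  where
  F : Framed c
  F = descendant-framed d
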